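{- For any $F\in\mathcal{F}_n^{<5}$, $|\mathcal{E}^2_F|=2^{\eta(F)}$.
   Context: A Dyck path of semilength $n$ is a lattice path from $(0,n)$ to $(n,0)$ with unit east and south steps never going strictly below $y=n-x$; its height sequence $h_0\dots h_{2n}$ has $h_0=0$, $h_{i+1}=h_i\pm1$ according as step $i+1$ is east ($+$) or south ($-$); its height is $\max_i h_i$; $\eta(D)=|\{i:h_i=2\}|$. $\mathcal{F}_n$ is the set of Ferrers boards whose border $D_F$ is such a path, $\eta(F)=\eta(D_F)$, and $\mathcal{F}_n^{<5}$ those whose border has height $<5$. For $F\in\mathcal{F}_n^{<5}$ with border height sequence $h_0\dots h_{2n}$, $\mathcal{E}^2_F$ is the set of pairs $(D_0,D_F)$ with $D_0$ a Dyck path of semilength $n$ never strictly above $D_F$, whose height sequence $j_0\dots j_{2n}$ satisfies: $j_i=1$ if $h_i\in\{1,3\}$; $j_i=0$ if $h_i\in\{0,4\}$; $j_i\in\{0,2\}$ if $h_i=2$. -}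

module Defs where

open import Data.Bool using (Bool; true; false)
open import Data.Nat as ℕ using (ℕ; zero; suc; _*_)
open import Data.Integer as ℤ using (ℤ; +_; _≤_; _<_; _≟_)
open import Data.List using (List; []; _∷_; map; _++_; length; filter; last; zipWith)
open import Data.List.Relation.Unary.All using (All)
open import Data.List.Relation.Unary.All as All using ()
open import Data.Maybe using (Maybe; just)
open import Data.Product using (_×_)
open import Data.Sum using (_⊎_)
open import Relation.Binary.PropositionalEquality using (_≡_)
open import Relation.Nullary using (Dec)
open import Relation.Nullary.Decidable using (_×-dec_; _⊎-dec_; _→-dec_)
open import Data.Maybe.Properties using () renaming (≡-dec to maybe-≡-dec)
import Data.Nat.Properties as ℕP
import Data.Integer.Properties as ℤP

-- A step: true = east (+1), false = south (-1).
Step : Set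
Step = Bool

stepVal : Step → ℤ
stepVal true  = + 1
stepVal false = ℤ.- (+ 1)

heightsFrom : ℤ → List Step → List ℤ
heightsFrom h []       = h ∷ []
heightsFrom h (s ∷ ss) = h ∷ heightsFrom (h ℤ.+ stepVal s) ss

heights : List Step → List ℤ
heights = heightsFrom (+ 0)

IsDyck : ℕ → List Step → Set
IsDyck n D = (length D ≡ 2 * n) × All (+ 0 ≤_) (heights D) × (last (heights D) ≡ just (+ 0))

isDyck? : ∀ n D → Dec (IsDyck n D)
isDyck? n D = (length D ℕP.≟ 2 * n) ×-dec (All.all? (ℤP._≤?_ (+ 0)) (heights D))
              ×-dec maybe-≡-dec _≟_ (last (heights D)) (just (+ 0))

HeightBelow5 : List Step → Set
HeightBelow5 D = All (_< + 5) (heights D)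

η : List Step → ℕ
η D = length (filter (_≟ + 2) (heights D))

words : ℕ → List (List Step)
words zero    = [] ∷ []
words (suc m) = map (true ∷_) (words m) ++ map (false ∷_) (words m)

HeightCond : ℤ → ℤ → Set
HeightCond h j =
    ((h ≡ + 1 ⊎ h ≡ + 3) → j ≡ + 1)
  × ((h ≡ + 0 ⊎ h ≡ + 4) → j ≡ + 0)
  × (h ≡ + 2 → (j ≡ + 0 ⊎ j ≡ + 2))

heightCond? : ∀ h j → Dec (HeightCond h j)
heightCond? h j =
      (((h ≟ + 1) ⊎-dec (h ≟ + 3)) →-dec (j ≟ + 1))
  ×-dec ((((h ≟ + 0) ⊎-dec (h ≟ + 4)) →-dec (j ≟ + 0))
  ×-dec ((h ≟ + 2) →-dec ((j ≟ + 0) ⊎-dec (j ≟ + 2))))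

record HPair : Set where
  constructor _,,_
  field hF : ℤ
        h0 : ℤ

pairs : List Step → List Step → List HPair
pairs DF D0 = zipWith _,,_ (heights DF) (heights D0)

InE2 : ℕ → List Step → List Step → Set
InE2 n DF D0 =
    IsDyck n D0
  × All (λ p → HPair.h0 p ≤ HPair.hF p) (pairs DF D0)
  × All (λ p → HeightCond (HPair.hF p) (HPair.h0 p)) (pairs DF D0)

inE2? : ∀ n DF D0 → Dec (InE2 n DF D0)
inE2? n DF D0 = isDyck? n D0
  ×-dec (All.all? (λ p → HPair.h0 p ℤP.≤? HPair.hF p) (pairs DF D0)
  ×-dec All.all? (λ p → heightCond? (HPair.hF p) (HPair.h0 p)) (pairs DF D0))

-- |E²_F| : the pairs (D_0, D_F) with D_F fixed, counted via D_0 over all words of length 2n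
cardE2 : ℕ → List Step → ℕ
cardE2 n DF = length (filter (inE2? n DF) (words (2 * n)))

-- Walk along D_F and D₀ simultaneously. Inside the strip 0 ≤ h < 5 the constraint on
-- (h_i, j_i) leaves only six admissible pairs, and from each of them exactly one step of
-- D₀ stays admissible, except when D_F steps onto height 2, where both do. So the number
-- of D₀ is a product with one factor 2 per visit of D_F to height 2 (h_0 = 0 contributes
-- nothing). The Dyck conditions on D₀ are automatic: j ≥ 0 in all six pairs, and
-- h_{2n} = 0 forces j_{2n} = 0.
module Submission where

open import Data.Bool using (true; false; if_then_else_)
open import Data.Empty using (⊥-elim)
open import Data.Integer as ℤ using (ℤ; +_; -[1+_]; _≤_; _<_; _≟_)
import Data.Integer.Properties as ℤP
open import Data.List using (List; []; _∷_; _++_; map; length; filter; last; zipWith)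
open import Data.List.Properties using (filter-++; length-++; filter-≐; filter-none; filter-accept)
open import Data.List.Relation.Binary.Pointwise as Pointwise using (Pointwise; []; _∷_; Pointwise-length)
open import Data.List.Relation.Unary.All as All using (All; []; _∷_)
open import Data.List.Relation.Unary.All.Properties using (zipWith⁺)
open import Data.Maybe using (just)
import Data.Maybe.Properties as Maybe
open import Data.Nat as ℕ using (ℕ; suc; _+_; _*_; _^_)
import Data.Nat.Properties as ℕP
open import Data.Product using (_×_; _,_; proj₁; proj₂; ∃)
open import Data.Sum using (inj₁; inj₂)
open import Function using (_∘_)
open import Level using (Level)
open import Relation.Binary.PropositionalEquality using (_≡_; refl; sym; trans; cong; cong₂; module ≡-Reasoning)
open import Relation.Nullary using (Dec; yes; no; ¬_; does)
open import Relation.Nullary.Decidable using (_×-dec_; from-yes)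
open import Relation.Unary using (Pred; Decidable; _≐_)

open import Defs

private
  variable
    a b c p q r : Level
    A : Set a
    B : Set b
    C : Set c

⟦_⟧ : ∀ {P : Set p} → Dec P → ℕ
⟦ d ⟧ = if does d then 1 else 0

⟦⟧-case : ∀ {P : Set p} (d : Dec P) {m n : ℕ} → (P → m ≡ n) → (¬ P → m ≡ 0) → m ≡ ⟦ d ⟧ * n
⟦⟧-case (yes p) m≡n _  = trans (m≡n p) (sym (ℕP.*-identityˡ _))
⟦⟧-case (no ¬p) _   m≡0 = m≡0 ¬p

count : {P : Pred A p} → Decidable P → List A → ℕ
count P? = length ∘ filter P?

module _ {P : Pred A p} (P? : Decidable P) where

  count-∷ : ∀ x xs → count P? (x ∷ xs) ≡ ⟦ P? x ⟧ + count P? xs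
  count-∷ x xs with does (P? x)
  ... | true  = refl
  ... | false = refl

  count-++ : ∀ xs ys → count P? (xs ++ ys) ≡ count P? xs + count P? ys
  count-++ xs ys = trans (cong length (filter-++ P? xs ys)) (length-++ (filter P? xs))

  count-map : (f : B → A) → ∀ xs → count P? (map f xs) ≡ count (P? ∘ f) xs
  count-map f []       = refl
  count-map f (x ∷ xs) with does (P? (f x))
  ... | true  = cong suc (count-map f xs)
  ... | false = count-map f xs

  count-none : (∀ x → ¬ P x) → ∀ xs → count P? xs ≡ 0
  count-none ¬P xs = cong length (filter-none P? (All.universal ¬P xs))

count-words-suc : {P : Pred (List Step) p} (P? : Decidable P) → ∀ m →
  count P? (words (suc m)) ≡ count (P? ∘ (true ∷_)) (words m) + count (P? ∘ (false ∷_)) (words m)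
count-words-suc P? m =
  trans (count-++ P? (map (true ∷_) (words m)) (map (false ∷_) (words m)))
        (cong₂ _+_ (count-map P? (true ∷_) (words m)) (count-map P? (false ∷_) (words m)))

count-≐ : {P : Pred A p} {Q : Pred A q} (P? : Decidable P) (Q? : Decidable Q) →
  P ≐ Q → ∀ xs → count P? xs ≡ count Q? xs
count-≐ P? Q? P≐Q xs = cong length (filter-≐ P? Q? P≐Q xs)

zipWith⁻ : {P : Pred C p} (f : A → B → C) {xs : List A} {ys : List B} →
  length xs ≡ length ys → All P (zipWith f xs ys) →
  Pointwise (λ x y → P (f x y)) xs ys
zipWith⁻ f {[]}     {[]}     _ _ = []
zipWith⁻ f {x ∷ xs} {y ∷ ys} e (pxy ∷ ps) = pxy ∷ zipWith⁻ f (ℕP.suc-injective e) ps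

module _ {R : A → B → Set r} where

  All-along : {P : Pred A p} {Q : Pred B q} → (∀ {x y} → R x y → P x → Q y) →
    ∀ {xs ys} → Pointwise R xs ys → All P xs → All Q ys
  All-along f []         []         = []
  All-along f (rxy ∷ rs) (px ∷ ps) = f rxy px ∷ All-along f rs ps

  last-Pointwise : ∀ {xs ys x} → Pointwise R xs ys → last xs ≡ just x →
    ∃ λ y → last ys ≡ just y × R x y
  last-Pointwise (rxy ∷ [])        e with Maybe.just-injective e
  ... | refl = _ , refl , rxy
  last-Pointwise (_ ∷ rs@(_ ∷ _)) e = last-Pointwise rs e

All-heightsFrom-head : {P : Pred ℤ p} → ∀ {h} D → All P (heightsFrom h D) → P h
All-heightsFrom-head []      (ph ∷ _) = ph
All-heightsFrom-head (_ ∷ _) (ph ∷ _) = ph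

length-heightsFrom : ∀ h D → length (heightsFrom h D) ≡ suc (length D)
length-heightsFrom h []      = refl
length-heightsFrom h (s ∷ D) = cong suc (length-heightsFrom _ D)

twos : List ℤ → ℕ
twos = count (_≟ + 2)

twosAfter : ℤ → List Step → ℕ
twosAfter h []      = 0
twosAfter h (s ∷ D) = twos (heightsFrom (h ℤ.+ stepVal s) D)

twos-heightsFrom : ∀ h D → twos (heightsFrom h D) ≡ ⟦ h ≟ + 2 ⟧ + twosAfter h D
twos-heightsFrom h []      = count-∷ (_≟ + 2) h []
twos-heightsFrom h (s ∷ D) = count-∷ (_≟ + 2) h _

Admissible : ℤ → ℤ → Set
Admissible h j = j ≤ h × HeightCond h j

admissible? : ∀ h j → Dec (Admissible h j)
admissible? h j = (j ℤP.≤? h) ×-dec heightCond? h j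

InStrip : ℤ → Set
InStrip h = + 0 ≤ h × h < + 5

data AdmissiblePair : ℤ → ℤ → Set where
  s00 : AdmissiblePair (+ 0) (+ 0)
  s11 : AdmissiblePair (+ 1) (+ 1)
  s20 : AdmissiblePair (+ 2) (+ 0)
  s22 : AdmissiblePair (+ 2) (+ 2)
  s31 : AdmissiblePair (+ 3) (+ 1)
  s40 : AdmissiblePair (+ 4) (+ 0)

admissiblePair : ∀ {h j} → InStrip h → Admissible h j → AdmissiblePair h j
admissiblePair {+ 0} _ (_ , _ , zero , _) with zero (inj₁ refl)
... | refl = s00
admissiblePair {+ 1} _ (_ , odd , _) with odd (inj₁ refl)
... | refl = s11
admissiblePair {+ 2} _ (_ , _ , _ , two) with two refl
... | inj₁ refl = s20
... | inj₂ refl = s22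
admissiblePair {+ 3} _ (_ , odd , _) with odd (inj₂ refl)
... | refl = s31
admissiblePair {+ 4} _ (_ , _ , zero , _) with zero (inj₂ refl)
... | refl = s40
admissiblePair {+ suc (suc (suc (suc (suc _))))} (_ , ℤ.+<+ (ℕ.s≤s (ℕ.s≤s (ℕ.s≤s (ℕ.s≤s (ℕ.s≤s ())))))) _
admissiblePair { -[1+ _ ]} (() , _) _

admissiblePair-nonneg : ∀ {h j} → AdmissiblePair h j → + 0 ≤ j
admissiblePair-nonneg s00 = ℤ.+≤+ ℕ.z≤n
admissiblePair-nonneg s11 = ℤ.+≤+ ℕ.z≤n
admissiblePair-nonneg s20 = ℤ.+≤+ ℕ.z≤n
admissiblePair-nonneg s22 = ℤ.+≤+ ℕ.z≤n
admissiblePair-nonneg s31 = ℤ.+≤+ ℕ.z≤n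
admissiblePair-nonneg s40 = ℤ.+≤+ ℕ.z≤n

admissible-moves : ∀ {h j} → AdmissiblePair h j → ∀ s → InStrip (h ℤ.+ stepVal s) →
  let h′ = h ℤ.+ stepVal s in
  ⟦ admissible? h′ (j ℤ.+ stepVal true) ⟧ + ⟦ admissible? h′ (j ℤ.+ stepVal false) ⟧
    ≡ 2 ^ ⟦ h′ ≟ + 2 ⟧
admissible-moves s00 true  _ = refl
admissible-moves s00 false (() , _)
admissible-moves s11 true  _ = refl
admissible-moves s11 false _ = refl
admissible-moves s20 true  _ = refl
admissible-moves s20 false _ = refl
admissible-moves s22 true  _ = refl
admissible-moves s22 false _ = refl
admissible-moves s31 true  _ = refl
admissible-moves s31 false _ = refl
admissible-moves s40 true  (_ , 5<5) = ⊥-elim (ℤP.<-irrefl refl 5<5)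
admissible-moves s40 false _ = refl

Coupled : ℤ → ℤ → List Step → List Step → Set
Coupled h j DF D0 = Pointwise Admissible (heightsFrom h DF) (heightsFrom j D0)

coupled? : ∀ h j DF D0 → Dec (Coupled h j DF D0)
coupled? h j DF D0 = Pointwise.decidable admissible? (heightsFrom h DF) (heightsFrom j D0)

coupled-head : ∀ {h j} DF D0 → Coupled h j DF D0 → Admissible h j
coupled-head []      []      (a ∷ _) = a
coupled-head []      (_ ∷ _) (a ∷ _) = a
coupled-head (_ ∷ _) []      (a ∷ _) = a
coupled-head (_ ∷ _) (_ ∷ _) (a ∷ _) = a

completions : ℤ → ℤ → List Step → ℕ
completions h j DF = count (coupled? h j DF) (words (length DF))

completions-inadmissible : ∀ {h j} DF → ¬ Admissible h j → completions h j DF ≡ 0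
completions-inadmissible DF ¬a =
  count-none (coupled? _ _ DF) (λ D0 → ¬a ∘ coupled-head DF D0) (words (length DF))

completions-[] : ∀ {h j} → Admissible h j → completions h j [] ≡ 1
completions-[] {h} {j} a = cong length (filter-accept (coupled? h j []) {x = []} {xs = []} (a ∷ []))

completions-∷ : ∀ {h j} s DF → Admissible h j →
  let h′ = h ℤ.+ stepVal s in
  completions h j (s ∷ DF) ≡
    completions h′ (j ℤ.+ stepVal true) DF + completions h′ (j ℤ.+ stepVal false) DF
completions-∷ s DF a = trans (count-words-suc (coupled? _ _ (s ∷ DF)) (length DF))
  (cong₂ _+_ (count-≐ _ _ (Pointwise.tail , a ∷_) (words (length DF)))
             (count-≐ _ _ (Pointwise.tail , a ∷_) (words (length DF))))

completions-count : ∀ DF {h} → All InStrip (heightsFrom h DF) → ∀ j →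
  completions h j DF ≡ ⟦ admissible? h j ⟧ * 2 ^ twosAfter h DF
completions-admissible : ∀ DF {h j} → All InStrip (heightsFrom h DF) → Admissible h j →
  completions h j DF ≡ 2 ^ twosAfter h DF

completions-count DF {h} strip j =
  ⟦⟧-case (admissible? h j) (completions-admissible DF strip) (completions-inadmissible DF)

completions-admissible []       _ a = completions-[] a
completions-admissible (s ∷ DF) {h} {j} (inStrip ∷ strip) a = begin
  completions h j (s ∷ DF)
    ≡⟨ completions-∷ s DF a ⟩
  completions h′ j₊ DF + completions h′ j₋ DF
    ≡⟨ cong₂ _+_ (completions-count DF strip j₊) (completions-count DF strip j₋) ⟩
  ⟦ admissible? h′ j₊ ⟧ * 2 ^ t + ⟦ admissible? h′ j₋ ⟧ * 2 ^ t
    ≡⟨ sym (ℕP.*-distribʳ-+ (2 ^ t) ⟦ admissible? h′ j₊ ⟧ ⟦ admissible? h′ j₋ ⟧) ⟩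
  (⟦ admissible? h′ j₊ ⟧ + ⟦ admissible? h′ j₋ ⟧) * 2 ^ t
    ≡⟨ cong (_* 2 ^ t) moves ⟩
  2 ^ ⟦ h′ ≟ + 2 ⟧ * 2 ^ t
    ≡⟨ sym (ℕP.^-distribˡ-+-* 2 ⟦ h′ ≟ + 2 ⟧ t) ⟩
  2 ^ (⟦ h′ ≟ + 2 ⟧ + t)
    ≡⟨ cong (2 ^_) (sym (twos-heightsFrom h′ DF)) ⟩
  2 ^ twosAfter h (s ∷ DF) ∎
  where
  open ≡-Reasoning
  h′ j₊ j₋ : ℤ
  h′ = h ℤ.+ stepVal s
  j₊ = j ℤ.+ stepVal true
  j₋ = j ℤ.+ stepVal false
  t : ℕ
  t = twosAfter h′ DF
  moves : ⟦ admissible? h′ j₊ ⟧ + ⟦ admissible? h′ j₋ ⟧ ≡ 2 ^ ⟦ h′ ≟ + 2 ⟧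
  moves = admissible-moves (admissiblePair inStrip a) s (All-heightsFrom-head DF strip)

InE2⇒Coupled : ∀ {n DF D0} → IsDyck n DF → InE2 n DF D0 → Coupled (+ 0) (+ 0) DF D0
InE2⇒Coupled {DF = DF} {D0} (lenF , _) ((len0 , _) , below , cond) =
  zipWith⁻ _,,_ sameLength (All.zip (below , cond))
  where
  sameLength : length (heights DF) ≡ length (heights D0)
  sameLength = trans (length-heightsFrom _ DF)
    (trans (cong suc (trans lenF (sym len0))) (sym (length-heightsFrom _ D0)))

Coupled⇒InE2 : ∀ {n DF D0} → IsDyck n DF → All InStrip (heights DF) →
  Coupled (+ 0) (+ 0) DF D0 → InE2 n DF D0
Coupled⇒InE2 {n} {DF} {D0} (lenF , _ , lastF) strip coupled =
  (len0 , nonneg , last0) , zipWith⁺ _,,_ (Pointwise.map proj₁ coupled)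
                          , zipWith⁺ _,,_ (Pointwise.map proj₂ coupled)
  where
  len0 : length D0 ≡ 2 * n
  len0 = trans (ℕP.suc-injective (trans (sym (length-heightsFrom _ D0))
    (trans (sym (Pointwise-length coupled)) (length-heightsFrom _ DF)))) lenF
  nonneg : All (+ 0 ≤_) (heights D0)
  nonneg = All-along (λ a inStrip → admissiblePair-nonneg (admissiblePair inStrip a)) coupled strip
  last0 : last (heights D0) ≡ just (+ 0)
  last0 with last-Pointwise coupled lastF
  ... | _ , e , (_ , _ , zero , _) = trans e (cong just (zero (inj₁ refl)))

lemma6p4 : (n : ℕ) (DF : List Step) → IsDyck n DF → HeightBelow5 DF →
    cardE2 n DF ≡ 2 ^ η DF
lemma6p4 n DF dyck@(lenF , nonneg , _) below5 = begin
  cardE2 n DF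
    ≡⟨ count-≐ (inE2? n DF) (coupled? _ _ DF)
               (InE2⇒Coupled {n} dyck , Coupled⇒InE2 {n} dyck strip) (words (2 * n)) ⟩
  count (coupled? (+ 0) (+ 0) DF) (words (2 * n))
    ≡⟨ cong (count (coupled? _ _ DF) ∘ words) (sym lenF) ⟩
  completions (+ 0) (+ 0) DF
    ≡⟨ completions-admissible DF strip (from-yes (admissible? (+ 0) (+ 0))) ⟩
  2 ^ twosAfter (+ 0) DF
    ≡⟨ cong (2 ^_) (sym (twos-heightsFrom (+ 0) DF)) ⟩
  2 ^ η DF ∎
  where
  open ≡-Reasoning
  strip : All InStrip (heights DF)
  strip = All.zip (nonneg , below5)
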